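{- Let $S\subseteq\mathbb N^d$ be a good semigroup, $E\subsetneq S$ a proper good ideal with conductor $c_E=(c_1,\dots,c_d)$, $A=S\setminus E$ with levels $A_1,\dots,A_N$. Let $\alpha\in\mathbb N^d$ be such that $c_E\in\Delta^E_F(\alpha)$ for some nonempty $F\subsetneq I$ (i.e. $\alpha_i=c_i$ for $i\in F$ and $\alpha_j<c_j$ for $j\notin F$). For each $i$ the following are equivalent: (1) $\alpha\in A_i$; (2) $\widetilde\Delta_{\widehat F}(\alpha)\subseteq A_i$; (3) $\widetilde\Delta_{\widehat F}(\alpha)\cap A_i\neq\emptyset$.
   Context: $I=\{1,\dots,d\}$, $\le$ componentwise order on $\mathbb N^d$, $\wedge$ componentwise minimum, $\widehat F=I\setminus F$. A good semigroup is a submonoid $S$ of $(\mathbb N^d,+)$ with (G1) $\alpha\wedge\beta\in S$ for $\alpha,\beta\in S$; (G2) if $\alpha,\beta\in S$, $\alpha\ne\beta$, $\alpha_i=\beta_i$, there is $\epsilon\in S$ with $\epsilon_i>\alpha_i$, $\epsilon_j\ge\min(\alpha_j,\beta_j)$ for $j\ne i$, equality when $\alpha_j\ne\beta_j$; (G3) some $c\in S$ has $c+\mathbb N^d\subseteq S$. A good ideal is $E\subseteq S$ with $E+S\subseteq E$ satisfying (G1),(G2) inside $E$; its conductor is $c_E=\min\{\alpha:\alpha+\mathbb N^d\subseteq E\}$. $\Delta^X_F(\alpha)=\{\beta\in X:\beta_i=\alpha_i\ (i\in F),\ \beta_j>\alpha_j\ (j\notin F)\}$, $\widetilde\Delta_F(\alpha)=\{\beta\in\mathbb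 N^d:\beta_i=\alpha_i\ (i\in F),\ \beta_j\ge\alpha_j\ (j\notin F)\}\setminus\{\alpha\}$. $\alpha\ll\beta$ means $\alpha_i<\beta_i$ for all $i$. Complete infimum: $\alpha$ is a complete infimum of $\beta^{(1)},\dots,\beta^{(r)}\in Y\subseteq S$ ($r\ge2$) if there are nonempty $F_j\subsetneq I$ with $\beta^{(j)}\in\Delta^S_{F_j}(\alpha)$, $\beta^{(j)}\wedge\beta^{(k)}=\alpha$ ($j\ne k$), $\bigcap F_j=\emptyset$. Levels: inductively $B^{(i)}$ = elements $\alpha$ of $A\setminus(D^{(1)}\cup\cdots\cup D^{(i-1)})$ with no $\beta$ in that set satisfying $\alpha\ll\beta$; $C^{(i)}$ = elements of $B^{(i)}$ that are complete infima of $r$ elements of $B^{(i)}$, $2\le r\le d$; $D^{(i)}=B^{(i)}\setminus C^{(i)}$; $A=D^{(1)}\cup\cdots\cup D^{(N)}$ and $A_i:=D^{(N+1-i)}$. -}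

module Defs where

open import Data.Nat using (ℕ; zero; suc; _≤_; _<_; _+_; _⊓_)
open import Data.Fin using (Fin)
open import Data.Fin.Subset using (Subset; _∈_; _∉_; ∁; Nonempty)
open import Data.Vec using (Vec; lookup; zipWith; replicate)
open import Data.Product using (Σ; ∃; _×_; _,_)
open import Data.Empty using (⊥)
open import Relation.Nullary using (¬_)
open import Relation.Binary.PropositionalEquality using (_≡_; _≢_)

Pt : ℕ → Set
Pt d = Vec ℕ d

PSet : ℕ → Set₁
PSet d = Pt d → Set

module _ {d : ℕ} where

  0ᵥ : Pt d
  0ᵥ = replicate d 0

  _⊕_ : Pt d → Pt d → Pt d
  _⊕_ = zipWith _+_

  _∧_ : Pt d → Pt d → Pt d
  _∧_ = zipWith _⊓_

  _≤ᵥ_ : Pt d → Pt d → Set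
  α ≤ᵥ β = ∀ i → lookup α i ≤ lookup β i

  _≪_ : Pt d → Pt d → Set
  α ≪ β = ∀ i → lookup α i < lookup β i

  G1 : PSet d → Set
  G1 X = ∀ α β → X α → X β → X (α ∧ β)

  G2 : PSet d → Set
  G2 X = ∀ α β (i : Fin d) → X α → X β → α ≢ β → lookup α i ≡ lookup β i →
         ∃ λ ε → X ε × lookup α i < lookup ε i ×
           (∀ j → j ≢ i → (lookup (α ∧ β) j ≤ lookup ε j) ×
                          (lookup α j ≢ lookup β j → lookup ε j ≡ lookup (α ∧ β) j))

  record IsGoodSemigroup (S : PSet d) : Set where
    field
      zero∈ : S 0ᵥ
      +-closed : ∀ α β → S α → S β → S (α ⊕ β)
      g1 : G1 S
      g2 : G2 S
      g3 : ∃ λ c → S c × (∀ v → S (c ⊕ v))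

  record IsGoodIdeal (S E : PSet d) : Set where
    field
      ⊆S : ∀ α → E α → S α
      ideal : ∀ α β → E α → S β → E (α ⊕ β)
      g1 : G1 E
      g2 : G2 E

  IsConductor : PSet d → Pt d → Set
  IsConductor E c = (∀ v → E (c ⊕ v)) × (∀ α → (∀ v → E (α ⊕ v)) → c ≤ᵥ α)

  Δ : PSet d → Subset d → Pt d → PSet d
  Δ X F α β = X β × (∀ i → i ∈ F → lookup β i ≡ lookup α i)
                  × (∀ j → j ∉ F → lookup α j < lookup β j)

  Δ̃ : Subset d → Pt d → PSet d
  Δ̃ F α β = (∀ i → i ∈ F → lookup β i ≡ lookup α i)
            × (∀ j → j ∉ F → lookup α j ≤ lookup β j)
            × β ≢ α

  CompleteInf : PSet d → PSet d → PSet d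
  CompleteInf S Y α =
    Σ ℕ λ r → 2 ≤ r × r ≤ d ×
    Σ (Fin r → Pt d) λ β → Σ (Fin r → Subset d) λ F →
      (∀ j → Nonempty (F j) × Nonempty (∁ (F j))) ×
      (∀ j → Y (β j) × Δ S (F j) α (β j)) ×
      (∀ j k → j ≢ k → β j ∧ β k ≡ α) ×
      (∀ i → ∃ λ j → i ∉ F j)

  -- one step of the level construction, applied to the remaining set P
  Blev : PSet d → PSet d
  Blev P α = P α × (∀ β → P β → ¬ (α ≪ β))

  Dlev : PSet d → PSet d → PSet d
  Dlev S P α = Blev P α × ¬ CompleteInf S (Blev P) α

  -- Rem S A k = A ∖ (D⁽¹⁾ ∪ ⋯ ∪ D⁽ᵏ⁾)
  Rem : PSet d → PSet d → ℕ → PSet d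
  Rem S A zero = A
  Rem S A (suc k) α = Rem S A k α × ¬ Dlev S (Rem S A k) α

  -- D S A k = D⁽ᵏ⁾ (D⁽⁰⁾ is empty by convention)
  D : PSet d → PSet d → ℕ → PSet d
  D S A zero _ = ⊥
  D S A (suc k) = Dlev S (Rem S A k)

  NumLevels : PSet d → PSet d → ℕ → Set
  NumLevels S A N = (∀ α → A α → ∃ λ k → 1 ≤ k × k ≤ N × D S A k α)
                    × (∃ λ α → D S A N α)

-- Call δ and δ' indistinguishable when in every coordinate k they agree or both are ≥ cₖ.
-- A set X ⊆ ℕᵈ satisfying (G1), (G2) and containing c + ℕᵈ is a union of such classes once
-- d ≥ 2: taking the minimum with a point that is huge off coordinate i lowers γᵢ, and (G2)
-- applied to γ and that point raises it, so a coordinate already ≥ cᵢ can be moved to any value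
-- ≥ cᵢ. This applies to E and S. Translating by δ' − δ carries maximality for ≪ and complete
-- infima from δ to δ', so every level D⁽ᵏ⁾ of S ∖ E is a union of classes too; in particular the
-- level index, the number of levels and properness of E play no role. Finally α agrees with c
-- on F, so every β ∈ Δ̃_F̂(α) is indistinguishable from α, and raising one F-coordinate of α
-- gives such a β.

module Submission where

open import Defs
open import Data.Nat using (ℕ; zero; suc; s≤s; z≤n; _≤_; _<_; _∸_; _+_; _⊓_)
open import Data.Nat.Properties
  using (≤-reflexive; ≤-trans; <⇒≤; <⇒≢; n≤1+n; 1+n≢n;
         m≤m+n; m≤n+m; m<n+m; m<n⇒0<n∸m; m∸n+n≡m; n∸n≡0; m+[n∸m]≡n;
         m≤n⇒m⊓n≡m; m≥n⇒m⊓n≡n; +-distribʳ-⊓; ∸-distribʳ-⊓)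
open import Data.Fin using (Fin)
import Data.Fin.Properties as Fin
open import Data.Fin.Subset using (Subset; _∈_; _∉_; ∁; Nonempty)
open import Data.Fin.Subset.Properties using (_∈?_; x∈∁p⇒x∉p; x∉∁p⇒x∈p; x∈p⇒x∉∁p)
open import Data.Vec using (lookup; zipWith; _[_]≔_)
open import Data.Vec.Properties
  using (lookup-zipWith; lookup∘update; lookup∘update′; []≔-idempotent; []≔-lookup)
open import Data.Vec.Relation.Binary.Pointwise.Extensional using (ext; Pointwise-≡⇒≡)
open import Data.List using (List; []; _∷_; allFin)
open import Data.List.Relation.Unary.Any using (here; there)
import Data.List.Membership.Propositional as List
open import Data.List.Membership.Propositional.Properties using (∈-allFin)
open import Data.Product using (∃; _×_; _,_; proj₁; proj₂)
open import Data.Sum using (_⊎_; inj₁; inj₂)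
open import Data.Empty using (⊥-elim)
open import Function using (_∘_)
open import Relation.Nullary using (¬_; yes; no)
open import Relation.Binary.PropositionalEquality

module _ {d : ℕ} where

  ≡-pointwise : {u v : Pt d} → (∀ k → lookup u k ≡ lookup v k) → u ≡ v
  ≡-pointwise h = Pointwise-≡⇒≡ (ext h)

  ≪⇒≤ᵥ : (δ γ : Pt d) → δ ≪ γ → δ ≤ᵥ γ
  ≪⇒≤ᵥ _ _ δ≪γ = <⇒≤ ∘ δ≪γ

  Δ⇒≤ᵥ : ∀ (X : PSet d) F (δ β : Pt d) → Δ X F δ β → δ ≤ᵥ β
  Δ⇒≤ᵥ _ F _ _ (_ , β≡δ , δ<β) k with k ∈? F
  ... | yes k∈F = ≤-reflexive (sym (β≡δ k k∈F))
  ... | no k∉F = <⇒≤ (δ<β k k∉F)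

  other-coordinate : {a b : Fin d} → a ≢ b → (i : Fin d) → ∃ λ j → j ≢ i
  other-coordinate {a} {b} a≢b i with i Fin.≟ a
  ... | yes refl = b , ≢-sym a≢b
  ... | no i≢a = a , ≢-sym i≢a

  conductor-upward : ∀ (E : PSet d) c → (∀ v → E (c ⊕ v)) → ∀ η → c ≤ᵥ η → E η
  conductor-upward E c c⊕ℕᵈ⊆E η c≤η = subst E (≡-pointwise c⊕[η∸c]≗η) (c⊕ℕᵈ⊆E (zipWith _∸_ η c))
    where
      c⊕[η∸c]≗η : ∀ k → lookup (c ⊕ zipWith _∸_ η c) k ≡ lookup η k
      c⊕[η∸c]≗η k = trans (lookup-zipWith _+_ k c (zipWith _∸_ η c))
                          (trans (cong (lookup c k +_) (lookup-zipWith _∸_ k η c)) (m+[n∸m]≡n (c≤η k)))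

  Δ̃-update : ∀ {G : Subset d} (α : Pt d) {a} → a ∉ G → Δ̃ G α (α [ a ]≔ suc (lookup α a))
  Δ̃-update {G} α {a} a∉G =
    (λ k k∈G → lookup∘update′ (λ k≡a → a∉G (subst (_∈ G) k≡a k∈G)) α _) ,
    (λ k _ → α≤α[a]≔1+αₐ k) ,
    λ α[a]≔1+αₐ≡α → 1+n≢n (trans (sym (lookup∘update a α _)) (cong (λ v → lookup v a) α[a]≔1+αₐ≡α))
    where
      α≤α[a]≔1+αₐ : α ≤ᵥ (α [ a ]≔ suc (lookup α a))
      α≤α[a]≔1+αₐ k with k Fin.≟ a
      ... | yes refl = subst (lookup α k ≤_) (sym (lookup∘update k α _)) (n≤1+n _)
      ... | no k≢a = ≤-reflexive (sym (lookup∘update′ k≢a α _))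

  -- Translate γ by δ' − δ; no truncation occurs as long as δ ≤ᵥ γ.
  transport : Pt d → Pt d → Pt d → Pt d
  transport δ δ' γ = zipWith _∸_ γ δ ⊕ δ'

  lookup-transport : ∀ δ δ' γ k →
    lookup (transport δ δ' γ) k ≡ lookup γ k ∸ lookup δ k + lookup δ' k
  lookup-transport δ δ' γ k =
    trans (lookup-zipWith _+_ k (zipWith _∸_ γ δ) δ')
          (cong (_+ lookup δ' k) (lookup-zipWith _∸_ k γ δ))

  transport-≪ : ∀ δ δ' γ → δ ≪ γ → δ' ≪ transport δ δ' γ
  transport-≪ δ δ' γ δ≪γ k =
    subst (lookup δ' k <_) (sym (lookup-transport δ δ' γ k))
          (m<n+m (lookup δ' k) (m<n⇒0<n∸m (δ≪γ k)))

  transport-∧ : ∀ {δ β β'} δ' → β ∧ β' ≡ δ →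
    transport δ δ' β ∧ transport δ δ' β' ≡ δ'
  transport-∧ {δ} {β} {β'} δ' β∧β'≡δ = ≡-pointwise λ k → begin
    lookup (transport δ δ' β ∧ transport δ δ' β') k
      ≡⟨ lookup-zipWith _⊓_ k (transport δ δ' β) (transport δ δ' β') ⟩
    lookup (transport δ δ' β) k ⊓ lookup (transport δ δ' β') k
      ≡⟨ cong₂ _⊓_ (lookup-transport δ δ' β k) (lookup-transport δ δ' β' k) ⟩
    (lookup β k ∸ lookup δ k + lookup δ' k) ⊓ (lookup β' k ∸ lookup δ k + lookup δ' k)
      ≡⟨ sym (+-distribʳ-⊓ (lookup δ' k) _ _) ⟩
    (lookup β k ∸ lookup δ k) ⊓ (lookup β' k ∸ lookup δ k) + lookup δ' k
      ≡⟨ cong (_+ lookup δ' k) (sym (∸-distribʳ-⊓ (lookup δ k) (lookup β k) (lookup β' k))) ⟩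
    lookup β k ⊓ lookup β' k ∸ lookup δ k + lookup δ' k
      ≡⟨ cong (λ x → x ∸ lookup δ k + lookup δ' k)
              (trans (sym (lookup-zipWith _⊓_ k β β')) (cong (λ v → lookup v k) β∧β'≡δ)) ⟩
    lookup δ k ∸ lookup δ k + lookup δ' k
      ≡⟨ cong (_+ lookup δ' k) (n∸n≡0 (lookup δ k)) ⟩
    lookup δ' k ∎
    where open ≡-Reasoning

  overwrite : List (Fin d) → Pt d → Pt d → Pt d
  overwrite []       δ' γ = γ
  overwrite (i ∷ is) δ' γ = overwrite is δ' (γ [ i ]≔ lookup δ' i)

  lookup-overwrite : ∀ is δ' γ k → k List.∈ is ⊎ lookup γ k ≡ lookup δ' k →
    lookup (overwrite is δ' γ) k ≡ lookup δ' k
  lookup-overwrite []       δ' γ k (inj₂ γₖ≡δ'ₖ) = γₖ≡δ'ₖ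
  lookup-overwrite (i ∷ is) δ' γ k k∈i∷is⊎γₖ≡δ'ₖ =
    lookup-overwrite is δ' (γ [ i ]≔ lookup δ' i) k (after-update k∈i∷is⊎γₖ≡δ'ₖ)
    where
      updated : k ≡ i ⊎ lookup γ k ≡ lookup δ' k → lookup (γ [ i ]≔ lookup δ' i) k ≡ lookup δ' k
      updated k≡i⊎γₖ≡δ'ₖ with k Fin.≟ i | k≡i⊎γₖ≡δ'ₖ
      ... | yes refl | _                 = lookup∘update k γ (lookup δ' k)
      ... | no k≢i   | inj₁ k≡i          = ⊥-elim (k≢i k≡i)
      ... | no k≢i   | inj₂ γₖ≡δ'ₖ       = trans (lookup∘update′ k≢i γ (lookup δ' i)) γₖ≡δ'ₖ
      after-update : k List.∈ i ∷ is ⊎ lookup γ k ≡ lookup δ' k →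
        k List.∈ is ⊎ lookup (γ [ i ]≔ lookup δ' i) k ≡ lookup δ' k
      after-update (inj₁ (here k≡i))    = inj₂ (updated (inj₁ k≡i))
      after-update (inj₁ (there k∈is))  = inj₁ k∈is
      after-update (inj₂ γₖ≡δ'ₖ)        = inj₂ (updated (inj₂ γₖ≡δ'ₖ))

  overwrite-allFin : ∀ δ' γ → overwrite (allFin d) δ' γ ≡ δ'
  overwrite-allFin δ' γ =
    ≡-pointwise λ k → lookup-overwrite (allFin d) δ' γ k (inj₁ (∈-allFin k))

  module Indistinguishability (c : Pt d) where

    record Indist (δ δ' : Pt d) : Set where
      field
        at : ∀ k → lookup δ k ≡ lookup δ' k ⊎ (lookup c k ≤ lookup δ k × lookup c k ≤ lookup δ' k)

    open Indist

    Invariant : PSet d → Set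
    Invariant P = ∀ {δ δ'} → Indist δ δ' → P δ → P δ'

    Indist-sym : ∀ {δ δ'} → Indist δ δ' → Indist δ' δ
    at (Indist-sym δ∼δ') k with at δ∼δ' k
    ... | inj₁ δₖ≡δ'ₖ = inj₁ (sym δₖ≡δ'ₖ)
    ... | inj₂ (c≤δₖ , c≤δ'ₖ) = inj₂ (c≤δ'ₖ , c≤δₖ)

    Indist-transport : ∀ {δ δ' γ} → Indist δ δ' → δ ≤ᵥ γ → Indist γ (transport δ δ' γ)
    at (Indist-transport {δ} {δ'} {γ} δ∼δ' δ≤γ) k
      rewrite lookup-transport δ δ' γ k with at δ∼δ' k
    ... | inj₁ δₖ≡δ'ₖ rewrite sym δₖ≡δ'ₖ = inj₁ (sym (m∸n+n≡m (δ≤γ k)))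
    ... | inj₂ (c≤δₖ , c≤δ'ₖ) = inj₂ (≤-trans c≤δₖ (δ≤γ k) , ≤-trans c≤δ'ₖ (m≤n+m _ _))

    Indist-update : ∀ {γ δ'} i → Indist γ δ' → Indist (γ [ i ]≔ lookup δ' i) δ'
    at (Indist-update {γ} {δ'} i γ∼δ') k with k Fin.≟ i
    ... | yes refl = inj₁ (lookup∘update k γ (lookup δ' k))
    ... | no k≢i rewrite lookup∘update′ k≢i γ (lookup δ' i) = at γ∼δ' k

    Δ̃-Indist : ∀ G α β → (∀ k → k ∉ G → lookup c k ≤ lookup α k) → Δ̃ G α β → Indist α β
    at (Δ̃-Indist G α β c≤α-off-G (β≡α-on-G , α≤β-off-G , _)) k with k ∈? G
    ... | yes k∈G = inj₁ (sym (β≡α-on-G k k∈G))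
    ... | no k∉G = inj₂ (c≤α-off-G k k∉G , ≤-trans (c≤α-off-G k k∉G) (α≤β-off-G k k∉G))

    Invariant-∖ : ∀ {P Q : PSet d} → Invariant P → Invariant Q → Invariant (λ x → P x × ¬ Q x)
    Invariant-∖ P-inv Q-inv δ∼δ' (Pδ , ¬Qδ) = P-inv δ∼δ' Pδ , ¬Qδ ∘ Q-inv (Indist-sym δ∼δ')

    transport-Δ : ∀ {S δ δ'} F β → Invariant S → Indist δ δ' → Δ S F δ β →
      Δ S F δ' (transport δ δ' β)
    transport-Δ {S} {δ} {δ'} F β S-inv δ∼δ' Δβ@(Sβ , β≡δ , δ<β) =
      S-inv (Indist-transport δ∼δ' (Δ⇒≤ᵥ S F δ β Δβ)) Sβ ,
      (λ k k∈F → begin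
         lookup (transport δ δ' β) k         ≡⟨ lookup-transport δ δ' β k ⟩
         lookup β k ∸ lookup δ k + lookup δ' k ≡⟨ cong (λ x → x ∸ lookup δ k + lookup δ' k) (β≡δ k k∈F) ⟩
         lookup δ k ∸ lookup δ k + lookup δ' k ≡⟨ cong (_+ lookup δ' k) (n∸n≡0 (lookup δ k)) ⟩
         lookup δ' k                         ∎) ,
      (λ k k∉F → subst (lookup δ' k <_) (sym (lookup-transport δ δ' β k))
                       (m<n+m (lookup δ' k) (m<n⇒0<n∸m (δ<β k k∉F))))
      where open ≡-Reasoning

    Invariant-Blev : ∀ {P} → Invariant P → Invariant (Blev P)
    Invariant-Blev P-inv {δ} {δ'} δ∼δ' (Pδ , δ-maximal) =
      P-inv δ∼δ' Pδ ,
      λ γ Pγ δ'≪γ → δ-maximal (transport δ' δ γ)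
        (P-inv (Indist-transport (Indist-sym δ∼δ') (≪⇒≤ᵥ δ' γ δ'≪γ)) Pγ)
        (transport-≪ δ' δ γ δ'≪γ)

    Invariant-CompleteInf : ∀ {S Y} → Invariant S → Invariant Y → Invariant (CompleteInf S Y)
    Invariant-CompleteInf {S} S-inv Y-inv {δ} {δ'} δ∼δ' (r , 2≤r , r≤d , β , F , F-proper , β∈Δ , β∧β≡δ , ⋂F≡∅) =
      r , 2≤r , r≤d , transport δ δ' ∘ β , F , F-proper ,
      (λ j → Y-inv (Indist-transport δ∼δ' (Δ⇒≤ᵥ S (F j) δ (β j) (proj₂ (β∈Δ j)))) (proj₁ (β∈Δ j)) ,
             transport-Δ (F j) (β j) S-inv δ∼δ' (proj₂ (β∈Δ j))) ,
      (λ j k j≢k → transport-∧ δ' (β∧β≡δ j k j≢k)) ,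
      ⋂F≡∅

    Invariant-Dlev : ∀ {S P} → Invariant S → Invariant P → Invariant (Dlev S P)
    Invariant-Dlev S-inv P-inv δ∼δ' (Bδ , ¬CIδ) =
      Invariant-Blev P-inv δ∼δ' Bδ ,
      ¬CIδ ∘ Invariant-CompleteInf S-inv (Invariant-Blev P-inv) (Indist-sym δ∼δ')

    Invariant-Rem : ∀ {S A} → Invariant S → Invariant A → ∀ k → Invariant (Rem S A k)
    Invariant-Rem S-inv A-inv zero = A-inv
    Invariant-Rem S-inv A-inv (suc k) δ∼δ' (Rδ , ¬Dδ) =
      Invariant-Rem S-inv A-inv k δ∼δ' Rδ ,
      ¬Dδ ∘ Invariant-Dlev S-inv (Invariant-Rem S-inv A-inv k) (Indist-sym δ∼δ')

    Invariant-D : ∀ {S A} → Invariant S → Invariant A → ∀ k → Invariant (D S A k)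
    Invariant-D S-inv A-inv zero _ ()
    Invariant-D S-inv A-inv (suc k) = Invariant-Dlev S-inv (Invariant-Rem S-inv A-inv k)

    module _ {X : PSet d} (X-G1 : G1 X) (X-G2 : G2 X) (c≤⇒X : ∀ η → c ≤ᵥ η → X η)
             (other : (i : Fin d) → ∃ λ j → j ≢ i) where

      lifted : Pt d → Pt d
      lifted γ = zipWith (λ a b → suc (a + b)) γ c

      above : Pt d → Fin d → ℕ → Pt d
      above γ i y = lifted γ [ i ]≔ y

      lookup-above-off : ∀ γ {i k} y → k ≢ i → lookup (above γ i y) k ≡ suc (lookup γ k + lookup c k)
      lookup-above-off γ {i} {k} y k≢i =
        trans (lookup∘update′ k≢i (lifted γ) y)
              (lookup-zipWith (λ a b → suc (a + b)) k γ c)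

      below-above : ∀ γ {i k} y → k ≢ i → lookup γ k < lookup (above γ i y) k
      below-above γ y k≢i = subst (lookup γ _ <_) (sym (lookup-above-off γ y k≢i)) (s≤s (m≤m+n _ _))

      X-above : ∀ γ i y → lookup c i ≤ y → X (above γ i y)
      X-above γ i y cᵢ≤y = c≤⇒X (above γ i y) c≤above
        where
          c≤above : c ≤ᵥ above γ i y
          c≤above k with k Fin.≟ i
          ... | yes refl = subst (lookup c k ≤_) (sym (lookup∘update k (lifted γ) y)) cᵢ≤y
          ... | no k≢i = subst (lookup c k ≤_) (sym (lookup-above-off γ y k≢i))
                               (≤-trans (m≤n+m _ (lookup γ k)) (n≤1+n _))

      X-lower : ∀ {γ i y} → X γ → lookup c i ≤ y → y ≤ lookup γ i → X (γ [ i ]≔ y)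
      X-lower {γ} {i} {y} Xγ cᵢ≤y y≤γᵢ =
        subst X (≡-pointwise γ∧above≗γ[i]≔y) (X-G1 γ (above γ i y) Xγ (X-above γ i y cᵢ≤y))
        where
          γ∧above≗γ[i]≔y : ∀ k → lookup (γ ∧ above γ i y) k ≡ lookup (γ [ i ]≔ y) k
          γ∧above≗γ[i]≔y k rewrite lookup-zipWith _⊓_ k γ (above γ i y) with k Fin.≟ i
          ... | yes refl rewrite lookup∘update k (lifted γ) y
                               | lookup∘update k γ y = m≥n⇒m⊓n≡n y≤γᵢ
          ... | no k≢i rewrite lookup∘update′ k≢i γ y = m≤n⇒m⊓n≡m (<⇒≤ (below-above γ y k≢i))

      -- (G2) applied to γ and above γ i γᵢ, which differ in every coordinate but i.
      X-raise : ∀ {γ i} j → j ≢ i → X γ → lookup c i ≤ lookup γ i →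
        ∃ λ z → lookup γ i < z × X (γ [ i ]≔ z)
      X-raise {γ} {i} j j≢i Xγ cᵢ≤γᵢ
        with X-G2 γ η i Xγ (X-above γ i _ cᵢ≤γᵢ) γ≢η (sym (lookup∘update i (lifted γ) (lookup γ i)))
        where
          η : Pt d
          η = above γ i (lookup γ i)
          γ≢η : γ ≢ η
          γ≢η γ≡η = <⇒≢ (below-above γ (lookup γ i) j≢i) (cong (λ v → lookup v j) γ≡η)
      ... | ε , Xε , γᵢ<εᵢ , ε-off = lookup ε i , γᵢ<εᵢ , subst X (≡-pointwise ε≗γ[i]≔εᵢ) Xε
        where
          ε≗γ[i]≔εᵢ : ∀ k → lookup ε k ≡ lookup (γ [ i ]≔ lookup ε i) k
          ε≗γ[i]≔εᵢ k with k Fin.≟ i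
          ... | yes refl = sym (lookup∘update k γ (lookup ε k))
          ... | no k≢i = begin
            lookup ε k                            ≡⟨ proj₂ (ε-off k k≢i) (<⇒≢ (below-above γ _ k≢i)) ⟩
            lookup (γ ∧ above γ i (lookup γ i)) k ≡⟨ lookup-zipWith _⊓_ k γ _ ⟩
            lookup γ k ⊓ lookup (above γ i (lookup γ i)) k ≡⟨ m≤n⇒m⊓n≡m (<⇒≤ (below-above γ _ k≢i)) ⟩
            lookup γ k                            ≡⟨ sym (lookup∘update′ k≢i γ (lookup ε i)) ⟩
            lookup (γ [ i ]≔ lookup ε i) k        ∎
            where open ≡-Reasoning

      X-raise-beyond : ∀ {γ i} n → X γ → lookup c i ≤ lookup γ i →
        ∃ λ z → n ≤ z × lookup c i ≤ z × X (γ [ i ]≔ z)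
      X-raise-beyond {γ} {i} zero Xγ cᵢ≤γᵢ = lookup γ i , z≤n , cᵢ≤γᵢ , subst X (sym ([]≔-lookup γ i)) Xγ
      X-raise-beyond {γ} {i} (suc n) Xγ cᵢ≤γᵢ with X-raise-beyond n Xγ cᵢ≤γᵢ
      ... | z , n≤z , cᵢ≤z , Xγ[i]≔z
        with X-raise (proj₁ (other i)) (proj₂ (other i)) Xγ[i]≔z
               (subst (lookup c i ≤_) (sym (lookup∘update i γ z)) cᵢ≤z)
      ... | z' , γ[i]≔zᵢ<z' , Xγ[i]≔z[i]≔z'
        rewrite lookup∘update i γ z | []≔-idempotent {x = z} {y = z'} γ i =
          z' , ≤-trans (s≤s n≤z) γ[i]≔zᵢ<z' , ≤-trans cᵢ≤z (<⇒≤ γ[i]≔zᵢ<z') , Xγ[i]≔z[i]≔z'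

      X-reset : ∀ {γ i y} → X γ → lookup c i ≤ lookup γ i → lookup c i ≤ y → X (γ [ i ]≔ y)
      X-reset {γ} {i} {y} Xγ cᵢ≤γᵢ cᵢ≤y with X-raise-beyond y Xγ cᵢ≤γᵢ
      ... | z , y≤z , _ , Xγ[i]≔z =
        subst X ([]≔-idempotent γ i)
          (X-lower Xγ[i]≔z cᵢ≤y (subst (y ≤_) (sym (lookup∘update i γ z)) y≤z))

      X-update : ∀ {γ δ'} i → Indist γ δ' → X γ → X (γ [ i ]≔ lookup δ' i)
      X-update {γ} {δ'} i γ∼δ' Xγ with at γ∼δ' i
      ... | inj₁ γᵢ≡δ'ᵢ = subst X (trans (sym ([]≔-lookup γ i)) (cong (γ [ i ]≔_) γᵢ≡δ'ᵢ)) Xγ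
      ... | inj₂ (cᵢ≤γᵢ , cᵢ≤δ'ᵢ) = X-reset Xγ cᵢ≤γᵢ cᵢ≤δ'ᵢ

      X-overwrite : ∀ {γ δ'} is → Indist γ δ' → X γ → X (overwrite is δ' γ)
      X-overwrite []       γ∼δ' Xγ = Xγ
      X-overwrite (i ∷ is) γ∼δ' Xγ = X-overwrite is (Indist-update i γ∼δ') (X-update i γ∼δ' Xγ)

      Invariant-good : Invariant X
      Invariant-good {δ} {δ'} δ∼δ' Xδ = subst X (overwrite-allFin δ' δ) (X-overwrite (allFin d) δ∼δ' Xδ)

proposition2p9 : ∀ {d : ℕ} (S E : PSet d) (c : Pt d) (N : ℕ) →
    IsGoodSemigroup S → IsGoodIdeal S E → (∃ λ x → S x × ¬ E x) →
    IsConductor E c →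
    NumLevels S (λ x → S x × ¬ E x) N →
    (α : Pt d) (F : Subset d) → Nonempty F → Nonempty (∁ F) →
    Δ E F α c →
    (i : ℕ) → 1 ≤ i → i ≤ N →
    let Ai = D S (λ x → S x × ¬ E x) (suc N ∸ i) in
    (Ai α → ∀ β → Δ̃ (∁ F) α β → Ai β) ×
    ((∀ β → Δ̃ (∁ F) α β → Ai β) → Ai α) ×
    (Ai α → ∃ λ β → Δ̃ (∁ F) α β × Ai β) ×
    ((∃ λ β → Δ̃ (∁ F) α β × Ai β) → Ai α)
proposition2p9 S E c N gS gE _ (c⊕ℕᵈ⊆E , _) _ α F (a , a∈F) (b , b∈∁F) (_ , c≡α-on-F , _) i _ _ =
  (λ Aᵢα β β∈Δ̃ → Aᵢ-inv (α∼ β β∈Δ̃) Aᵢα) ,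
  (λ Aᵢ⊇Δ̃ → Aᵢ-inv (Indist-sym (α∼ β₀ β₀∈Δ̃)) (Aᵢ⊇Δ̃ β₀ β₀∈Δ̃)) ,
  (λ Aᵢα → β₀ , β₀∈Δ̃ , Aᵢ-inv (α∼ β₀ β₀∈Δ̃) Aᵢα) ,
  (λ (β , β∈Δ̃ , Aᵢβ) → Aᵢ-inv (Indist-sym (α∼ β β∈Δ̃)) Aᵢβ)
  where
    open Indistinguishability c
    E-upward : ∀ η → c ≤ᵥ η → E η
    E-upward = conductor-upward E c c⊕ℕᵈ⊆E
    other : ∀ k → ∃ λ j → j ≢ k
    other = other-coordinate λ a≡b → x∈∁p⇒x∉p b∈∁F (subst (_∈ F) a≡b a∈F)
    E-inv : Invariant E
    E-inv = Invariant-good (IsGoodIdeal.g1 gE) (IsGoodIdeal.g2 gE) E-upward other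
    S-inv : Invariant S
    S-inv = Invariant-good (IsGoodSemigroup.g1 gS) (IsGoodSemigroup.g2 gS)
              (λ η c≤η → IsGoodIdeal.⊆S gE η (E-upward η c≤η)) other
    Aᵢ-inv : Invariant (D S (λ x → S x × ¬ E x) (suc N ∸ i))
    Aᵢ-inv = Invariant-D S-inv (Invariant-∖ S-inv E-inv) (suc N ∸ i)
    α∼ : ∀ β → Δ̃ (∁ F) α β → Indist α β
    α∼ β = Δ̃-Indist (∁ F) α β λ k k∉∁F → ≤-reflexive (c≡α-on-F k (x∉∁p⇒x∈p k∉∁F))
    β₀ : Pt _
    β₀ = α [ a ]≔ suc (lookup α a)
    β₀∈Δ̃ : Δ̃ (∁ F) α β₀
    β₀∈Δ̃ = Δ̃-update α (x∈p⇒x∉∁p a∈F)
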